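{- Let $R,S$ be finite digraphs, let $\mathfrak{D}'$ be a class of finite digraphs, and let $\mathcal{E}(R),\mathcal{E}(S)$, $\phi_R,\phi_S$, $\alpha^R,\alpha^S$ be as in the context. Let $\epsilon:\mathcal{E}(R)\to\mathcal{E}(S)$ be a strict homomorphism, with induced S-scheme $\eta$. Assume: (a) for all $\mathfrak{a},\mathfrak{b}\in\mathcal{E}_o(R)$, $\epsilon(\mathfrak{a})=\epsilon(\mathfrak{b})$ implies $\phi_R(\mathfrak{a})=\phi_R(\mathfrak{b})$; (b) for every $G\in\mathfrak{D}'$, every $\xi\in\mathcal{S}(G,R)$ and every $v\in E_G(\xi)$, there exists $\mathfrak{a}\in\phi_R^{ -1}(\xi(v))$ with $\alpha^S_{G,\eta_G(\xi)}(v)=\epsilon(\mathfrak{a})$. Then for every $r\in V(R)$, every $G\in\mathfrak{D}'$ and every $\xi\in\mathcal{S}(G,R)$, $$\xi^{ -1}(r)\cap E_G(\xi)=\bigcup_{\mathfrak{a}\in\phi_R^{ -1}(r)}\big(\alpha^S_{G,\eta_G(\xi)}\big)^{ -1}\big(\epsilon(\mathfrak{a})\big).$$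
   Context: Digraphs have a finite nonempty vertex set; loops are allowed. A homomorphism maps arcs to arcs; it is strict if, in addition, it maps proper arcs $vw$ ($v\ne w$) to proper arcs. $\mathcal{S}(G,H)$ is the set of strict homomorphisms $G\to H$. $\mathfrak{D}'$ is a class of finite digraphs. An S-scheme from $R$ to $S$ with respect to $\mathfrak{D}'$ is a family of maps $\mathcal{S}(G,R)\to\mathcal{S}(G,S)$, $G\in\mathfrak{D}'$. Auxiliary data: - $\mathcal{E}(R),\mathcal{E}(S)$ are finite digraphs with vertex sets $\mathcal{E}_o(R),\mathcal{E}_o(S)$. - $\phi_R\in\mathcal{S}(\mathcal{E}(R),R)$ and $\phi_S\in\mathcal{S}(\mathcal{E}(S),S)$. - $\alpha^R$ is an S-scheme from $R$ to $\mathcal{E}(R)$ with $\phi_R\circ\alpha^R_{G,\xi}=\xi$ for all $G\in\mathfrak{D}'$ and $\xi\in\mathcal{S}(G,R)$. - $\alpha^S$ is an S-scheme from $S$ to $\mathcal{E}(S)$ with $\phi_S\circ\alpha^S_{G,\zeta}=\zeta$ for all $G\in\mathfrak{D}'$ and $\zeta\in\mathcal{S}(G,S)$. The S-scheme induced by $\epsilon$ is $\eta_G(\xi)=\phi_S\circ\epsilon\circ\alpha^R_{G,\xi}\in\mathcal{S}(G,S)$. Moreover, $$E_G(\xi)=\{v\in V(G):\alpha^S_{G,\eta_G(\xi)}(v)\in\epsilon[\mathcal{E}_o(R)]\}.$$ $f^{ -1}(y)$ denotes a preimage. -}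

module Defs where

open import Data.Nat using (ℕ; suc)
open import Data.Fin using (Fin)
open import Data.Bool using (Bool; true)
open import Data.Product using (∃; _×_)
open import Relation.Binary.PropositionalEquality using (_≡_; _≢_)

-- A finite digraph (loops allowed) with nonempty vertex set Fin (suc n);
-- the arc relation is given by a Boolean adjacency function.
record Digraph : Set where
  field
    size : ℕ
    arc  : Fin (suc size) → Fin (suc size) → Bool

V : Digraph → Set
V G = Fin (suc (Digraph.size G))

Arc : (G : Digraph) → V G → V G → Set
Arc G u w = Digraph.arc G u w ≡ true

record SHom (G H : Digraph) : Set where
  field
    map      : V G → V H
    arcs     : ∀ u w → Arc G u w → Arc H (map u) (map w)
    proper   : ∀ u w → u ≢ w → Arc G u w → map u ≢ map w
open SHom public

_∘S_ : ∀ {G H K} → SHom H K → SHom G H → SHom G K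
map    (g ∘S f) v = map g (map f v)
arcs   (g ∘S f) u w a = arcs g _ _ (arcs f u w a)
proper (g ∘S f) u w u≢w a = proper g _ _ (proper f u w u≢w a) (arcs f u w a)

DigraphClass : Set₁
DigraphClass = Digraph → Set

SScheme : DigraphClass → Digraph → Digraph → Set
SScheme D' R S = (G : Digraph) → D' G → SHom G R → SHom G S

induced : ∀ {D' R S ER ES} → SHom ES S → SHom ER ES → SScheme D' R ER → SScheme D' R S
induced φS ε αR G g ξ = φS ∘S (ε ∘S αR G g ξ)

InE : ∀ {D' R S ER ES} → SHom ES S → SHom ER ES → SScheme D' R ER → SScheme D' S ES →
      (G : Digraph) → D' G → SHom G R → V G → Set
InE {ER = ER} φS ε αR αS G g ξ v =
  ∃ λ (a : V ER) → map (αS G g (induced φS ε αR G g ξ)) v ≡ map ε a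

module Submission where

open import Defs
open import Data.Product using (∃; _×_; _,_)
open import Function.Bundles using (_⇔_; mk⇔)
open import Relation.Binary.PropositionalEquality using (_≡_; sym; trans)

-- Hypothesis (a) says φ factors through ε; hypothesis (b) then lifts a point x of the image
-- of ε to a preimage lying over the prescribed value y.  Together they show that every
-- ε-preimage of x lies over y, which is the whole content of the fibre identity.
module _ {A B C : Set} (ε : A → B) (φ : A → C)
         (φ-factors-through-ε : ∀ a b → ε a ≡ ε b → φ a ≡ φ b) where

  lift-over : (x : B) (y : C) → Set
  lift-over x y = ∃ λ a → (φ a ≡ y) × (x ≡ ε a)

  preimage-lies-over : ∀ {x y} → lift-over x y → ∀ a → x ≡ ε a → φ a ≡ y
  preimage-lies-over (b , φb≡y , x≡εb) a x≡εa =
    trans (φ-factors-through-ε a b (trans (sym x≡εa) x≡εb)) φb≡y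

  fibre-∩-image⇔⋃-fibres : ∀ (x : B) (y r : C) →
    ((∃ λ a → x ≡ ε a) → lift-over x y) →
    ((y ≡ r) × (∃ λ a → x ≡ ε a)) ⇔ lift-over x r
  fibre-∩-image⇔⋃-fibres x y r lift = mk⇔ to from
    where
    to : (y ≡ r) × (∃ λ a → x ≡ ε a) → lift-over x r
    to (y≡r , inImage) with lift inImage
    ... | a , φa≡y , x≡εa = a , trans φa≡y y≡r , x≡εa

    from : lift-over x r → (y ≡ r) × (∃ λ a → x ≡ ε a)
    from (a , φa≡r , x≡εa) =
      trans (sym (preimage-lies-over (lift (a , x≡εa)) a x≡εa)) φa≡r , (a , x≡εa)

proposition2 : (D' : DigraphClass) (R S ER ES : Digraph)
    (φR : SHom ER R) (φS : SHom ES S)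
    (αR : SScheme D' R ER) (αS : SScheme D' S ES) →
    (∀ G (g : D' G) (ξ : SHom G R) (v : V G) → map φR (map (αR G g ξ) v) ≡ map ξ v) →
    (∀ G (g : D' G) (ζ : SHom G S) (v : V G) → map φS (map (αS G g ζ) v) ≡ map ζ v) →
    (ε : SHom ER ES) →
    (∀ (a b : V ER) → map ε a ≡ map ε b → map φR a ≡ map φR b) →
    (∀ G (g : D' G) (ξ : SHom G R) (v : V G) → InE φS ε αR αS G g ξ v →
       ∃ λ (a : V ER) → (map φR a ≡ map ξ v)
         × (map (αS G g (induced φS ε αR G g ξ)) v ≡ map ε a)) →
    ∀ (r : V R) G (g : D' G) (ξ : SHom G R) (v : V G) →
      ((map ξ v ≡ r) × InE φS ε αR αS G g ξ v)
      ⇔ (∃ λ (a : V ER) → (map φR a ≡ r)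
           × (map (αS G g (induced φS ε αR G g ξ)) v ≡ map ε a))
proposition2 D' R S ER ES φR φS αR αS _ _ ε factors lift r G g ξ v =
  fibre-∩-image⇔⋃-fibres (map ε) (map φR) factors
    (map (αS G g (induced φS ε αR G g ξ)) v) (map ξ v) r (lift G g ξ v)
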